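{- Let $\mathcal{X}=(V,\mathcal{B})$ be a symmetric configuration $v_3$ for some odd $v\geq 7$, and let $G$ be its Levi graph. Suppose there exists a subset $S\subseteq V$ with $|S|=(v-1)/2$ such that every block $B\in\mathcal{B}$ contains a point of $S$, and the subgraph of $G$ induced by $S\cup\mathcal{B}$ is connected. Then $\mathcal{X}$ is upper embeddable in every orientation of triples.
   Context: A symmetric configuration $v_3$ is a pair $(V,\mathcal{B})$ where $V$ is a set of $v$ points and $\mathcal{B}$ is a set of $v$ three-element subsets of $V$ (blocks, or triples) such that each point lies in exactly $3$ blocks and any two distinct points lie in at most one block. Its Levi graph is the bipartite graph with vertex set $V\cup\mathcal{B}$, where a point $p$ is adjacent to a block $B$ iff $p\in B$; configurations are assumed connected, i.e. the Levi graph is connected. The associated graph $K$ has vertex set $V$ and an edge $uv$ for each pair of distinct points lying in a common block. An embedding of the configuration is a cellular embedding of $K$ in a closed orientable surface such that every block triangle bounds a face (a block face); the other faces are outer faces. It is an upper embedding if there is exactly one outer face. An orientation of triples assigns to each block a cyclic order of its three points; the configuration is upper embeddable in that orientation if it has an upper embedding in which the orientation of the surface induces the preassigned cyclic order on every block face. It is upper embeddable in every orientation if this holds for every orientation of triples. -}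

module Defs where

open import Data.Nat using (ℕ; zero; suc)
open import Data.Bool using (Bool; true; false)
open import Data.Fin using (Fin; zero; suc; _≟_)
open import Data.Fin.Subset using (Subset; ∣_∣; _∈_)
open import Data.Fin.Properties using (any?)
open import Data.Vec using (tabulate)
open import Data.Product using (Σ; ∃; ∃-syntax; _×_; _,_; proj₁; proj₂)
open import Data.Sum using (_⊎_; inj₁; inj₂)
open import Data.Empty using (⊥)
open import Data.Unit using (⊤)
open import Relation.Nullary using (¬_; does)
open import Relation.Binary.PropositionalEquality using (_≡_; _≢_)
open import Relation.Binary.Construct.Closure.ReflexiveTransitive using (Star)
open import Function.Definitions using (Injective)

iter : {A : Set} → ℕ → (A → A) → A → A
iter zero    f x = x
iter (suc k) f x = f (iter k f x)

Triples : ℕ → Set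
Triples v = Fin v → Fin 3 → Fin v

module _ {v : ℕ} (blk : Triples v) where

  _∈ᵇ_ : Fin v → Fin v → Set
  p ∈ᵇ b = ∃[ i ] blk b i ≡ p

  blocksThrough : Fin v → Subset v
  blocksThrough p = tabulate (λ b → does (any? (λ i → blk b i ≟ p)))

  -- adjacency in the Levi graph, whose vertices are points (inj₁) and blocks (inj₂)
  LeviAdj : Fin v ⊎ Fin v → Fin v ⊎ Fin v → Set
  LeviAdj (inj₁ p) (inj₂ b) = p ∈ᵇ b
  LeviAdj (inj₂ b) (inj₁ p) = p ∈ᵇ b
  LeviAdj (inj₁ _) (inj₁ _) = ⊥
  LeviAdj (inj₂ _) (inj₂ _) = ⊥

  LeviConnected : Set
  LeviConnected = ∀ x y → Star LeviAdj x y

  InSB : Subset v → Fin v ⊎ Fin v → Set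
  InSB S (inj₁ p) = p ∈ S
  InSB S (inj₂ b) = ⊤

  InducedAdj : Subset v → Fin v ⊎ Fin v → Fin v ⊎ Fin v → Set
  InducedAdj S x y = InSB S x × InSB S y × LeviAdj x y

  InducedConnected : Subset v → Set
  InducedConnected S = ∀ x y → InSB S x → InSB S y → Star (InducedAdj S) x y

  KAdj : Fin v → Fin v → Set
  KAdj u w = u ≢ w × ∃[ b ] (u ∈ᵇ b × w ∈ᵇ b)

record SymConfig (v : ℕ) : Set where
  field
    blk       : Triples v
    distinct  : ∀ b → Injective _≡_ _≡_ (blk b)
    regular   : ∀ p → ∣ blocksThrough blk p ∣ ≡ 3
    -- two distinct points lie in at most one block
    -- (this also forces distinct block indices to have distinct point sets)
    linear    : ∀ p q b b' → p ≢ q → _∈ᵇ_ blk p b → _∈ᵇ_ blk q b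
                  → _∈ᵇ_ blk p b' → _∈ᵇ_ blk q b' → b ≡ b'
    connected : LeviConnected blk

-- Orientation of triples: for each block a Bool choosing its cyclic order;
-- true : blk b 0 → blk b 1 → blk b 2 → blk b 0,  false : the reverse cyclic order.
Orientation : ℕ → Set
Orientation v = Fin v → Bool

succ3 : Bool → Fin 3 → Fin 3
succ3 true  zero             = suc zero
succ3 true  (suc zero)       = suc (suc zero)
succ3 true  (suc (suc zero)) = zero
succ3 false zero             = suc (suc zero)
succ3 false (suc zero)       = zero
succ3 false (suc (suc zero)) = suc zero

-- Cellular embeddings of the connected graph K in closed orientable surfaces are
-- described (Heffter–Edmonds) by rotation systems: rot u is a cyclic permutation
-- of the neighbourhood of u in K (its values outside the neighbourhood are irrelevant).
module _ {v : ℕ} (X : SymConfig v) where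
  open SymConfig X

  IsRotation : (Fin v → Fin v → Fin v) → Set
  IsRotation rot =
      (∀ u w → KAdj blk u w → KAdj blk u (rot u w))
    × (∀ u w w' → KAdj blk u w → KAdj blk u w' → ∃[ k ] iter (suc k) (rot u) w ≡ w')

  Dart : Set
  Dart = Fin v × Fin v

  faceStep : (Fin v → Fin v → Fin v) → Dart → Dart
  faceStep rot (u , w) = (w , rot w u)

  -- every block triangle, traversed in its preassigned cyclic order, is a face
  BlockFacesOriented : Orientation v → (Fin v → Fin v → Fin v) → Set
  BlockFacesOriented o rot = ∀ b i →
    rot (blk b (succ3 (o b) i)) (blk b i) ≡ blk b (succ3 (o b) (succ3 (o b) i))

  BlockDart : Orientation v → Dart → Set
  BlockDart o (u , w) = ∃[ b ] ∃[ i ] (blk b i ≡ u × blk b (succ3 (o b) i) ≡ w)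

  OuterDart : Orientation v → Dart → Set
  OuterDart o d = KAdj blk (proj₁ d) (proj₂ d) × ¬ BlockDart o d

  OneOuterFace : Orientation v → (Fin v → Fin v → Fin v) → Set
  OneOuterFace o rot = ∃[ d₀ ] (OuterDart o d₀ ×
    (∀ d → OuterDart o d → ∃[ k ] iter k (faceStep rot) d₀ ≡ d))

  UpperEmbeddableIn : Orientation v → Set
  UpperEmbeddableIn o = ∃[ rot ] (IsRotation rot × BlockFacesOriented o rot × OneOuterFace o rot)

  UpperEmbeddableInEveryOrientation : Set
  UpperEmbeddableInEveryOrientation = ∀ (o : Orientation v) → UpperEmbeddableIn o

-- A rotation system inducing o on the block triangles amounts to a
-- choice, at every point, of a cyclic order of its three blocks; the outer faces are then the
-- orbits of a permutation of the flags (block, position), and the embedding is upper exactly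
-- when this permutation is a single cycle. Before any choice is made, every block is a 3-cycle
-- of its own. Making the choice at a point composes the permutation with a 3-cycle on the three
-- flags at that point: this merges three distinct cycles into one, and keeps a single cycle
-- single for one of the two orders. We first merge along S: while some block is missed,
-- connectivity of the subgraph induced by S ∪ 𝓑 yields a point s ∈ S on a block of the current
-- cycle and on a block outside it, and counting (each point of S brings in at most two blocks,
-- while 2|S| < v) shows that exactly one block at s is on the cycle, so the other two can be
-- merged in. After (v-1)/2 such steps the cycle passes through all v blocks, and the remaining
-- points are then decided one at a time.

module Submission where

open import Defs
open import Data.Nat using (ℕ; zero; suc; _+_; _*_; _∸_; _/_; _%_; _≤_; _<_; s≤s; z≤n)
open import Data.Nat.Properties
  using (module ≤-Reasoning; +-assoc; +-identityʳ; +-suc; *-comm; *-suc; 1+n≢0; m+n≡0⇒m≡0; m+n≡0⇒n≡0; n≤0⇒n≡0;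
         ≤-refl; ≤-reflexive; ≤-trans; n≤1+n; m≤n+m; +-monoˡ-≤; +-monoʳ-≤; *-monoʳ-≤; +-cancelˡ-≤;
         <-irrefl; n<1+n; 1+n≰n; ≰⇒>; m+[n∸m]≡n)
open import Data.Nat.DivMod using (m≡m%n+[m/n]*n; m*n/n≡m)
open import Data.Nat.Tactic.RingSolver using (solve-∀)
open import Data.Bool using (Bool; true; false; if_then_else_)
open import Data.Fin using (Fin; zero; suc; _≟_)
open import Data.Fin.Properties using (any?; all?; ¬∀⟶∃¬) renaming (suc-injective to fsuc-injective)
open import Data.Fin.Subset using (Subset; ∣_∣; _∈_; _∉_; _⊆_; ⁅_⁆; ⊤; inside; outside) renaming (⊥ to ∅)
open import Data.Fin.Subset.Properties
  using (_∈?_; x∈⁅x⁆; x≢y⇒x∉⁅y⁆; ∉⊥; ⊥⊆; ∣⁅x⁆∣≡1; ∣⊥∣≡0; ∣⊤∣≡n; p⊆q⇒∣p∣≤∣q∣; p⊂q⇒∣p∣<∣q∣)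
open import Data.Vec using (Vec; []; _∷_; here; there; lookup; replicate; _[_]≔_)
open import Data.Vec.Properties
  using ([]≔-updates; []≔-minimal; []≔-lookup; lookup∘tabulate; lookup∘update; lookup∘update′; []=⇒lookup; lookup⇒[]=)
open import Data.List using (List; []; _∷_; _++_; map; length; allFin)
open import Data.List.Properties using (++-assoc; length-map)
open import Data.List.Membership.Propositional using () renaming (_∈_ to _∈ₗ_)
open import Data.List.Membership.Propositional.Properties using (∈-∃++; ∈-++⁻; ∈-map⁺; ∈-map⁻; ∈-allFin)
open import Data.List.Relation.Unary.Any using (here; there)
open import Data.List.Relation.Unary.All as All using (All; []; _∷_)
import Data.List.Relation.Unary.All.Properties as All
open import Data.List.Relation.Unary.AllPairs using ([]; _∷_)
open import Data.List.Relation.Unary.Unique.Propositional using (Unique)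
import Data.List.Relation.Unary.Unique.Propositional.Properties as Unique
open import Data.Product using (Σ; ∃-syntax; _×_; _,_; proj₁; proj₂)
open import Data.Product.Properties using (≡-dec)
open import Data.Sum using (_⊎_; inj₁; inj₂; [_,_]′)
open import Data.Unit using (tt)
open import Data.Empty using (⊥; ⊥-elim)
open import Function using (_∘_)
open import Function.Definitions using (Injective)
open import Relation.Nullary using (Dec; does; proof; yes; no; ¬_; contradiction; _×-dec_)
open import Relation.Nullary.Decidable using (dec-true; dec-false)
open import Relation.Nullary.Reflects using (Reflects; invert)
open import Relation.Binary using (DecidableEquality)
open import Relation.Binary.PropositionalEquality
open import Relation.Binary.Construct.Closure.ReflexiveTransitive using (Star; ε; _◅_)

-- Cycles of an endofunction

iter-commute : ∀ {A B : Set} {f : A → A} {F : B → B} (g : B → A) → (∀ p → f (g p) ≡ g (F p)) →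
               ∀ m p → iter m f (g p) ≡ g (iter m F p)
iter-commute g comm zero    p = refl
iter-commute {f = f} {F} g comm (suc m) p = trans (cong f (iter-commute g comm m p)) (comm (iter m F p))


module Cycles {A : Set} (_≟_ : DecidableEquality A) where

  δ : A → A → ℕ
  δ z x = if does (z ≟ x) then 1 else 0

  δ-refl : ∀ z → δ z z ≡ 1
  δ-refl z rewrite dec-true (z ≟ z) refl = refl

  δ-≢ : ∀ {z x} → z ≢ x → δ z x ≡ 0
  δ-≢ {z} {x} z≢x rewrite dec-false (z ≟ x) z≢x = refl

  count : A → List A → ℕ
  count z []       = 0
  count z (x ∷ xs) = δ z x + count z xs

  count-++ : ∀ z xs ys → count z (xs ++ ys) ≡ count z xs + count z ys
  count-++ z []       ys = refl
  count-++ z (x ∷ xs) ys = trans (cong (δ z x +_) (count-++ z xs ys)) (sym (+-assoc (δ z x) _ _))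

  count-segments : ∀ z a b c X Y Z →
    count z (a ∷ X ++ b ∷ Y ++ c ∷ Z) ≡ count z (a ∷ b ∷ c ∷ []) + (count z X + count z Y + count z Z)
  count-segments z a b c X Y Z rewrite count-++ z X (b ∷ Y ++ c ∷ Z) | count-++ z Y (c ∷ Z) =
    regroup (δ z a) (δ z b) (δ z c) (count z X) (count z Y) (count z Z)
    where
      regroup : ∀ p q r x y w → p + (x + (q + (y + (r + w)))) ≡ p + (q + (r + 0)) + (x + y + w)
      regroup = solve-∀

  ∈⇒count : ∀ {z xs} → z ∈ₗ xs → 1 ≤ count z xs
  ∈⇒count {z} {_ ∷ xs} (here refl) rewrite δ-refl z = s≤s z≤n
  ∈⇒count {z} {x ∷ _} (there z∈xs) = ≤-trans (∈⇒count z∈xs) (m≤n+m _ (δ z x))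

  count⇒∈ : ∀ {z} xs → 1 ≤ count z xs → z ∈ₗ xs
  count⇒∈ {z} (x ∷ xs) h with z ≟ x
  ... | yes refl = here refl
  ... | no _     = there (count⇒∈ xs h)

  count≡0⇒All≢ : ∀ z xs → count z xs ≡ 0 → All (z ≢_) xs
  count≡0⇒All≢ z []       _ = []
  count≡0⇒All≢ z (x ∷ xs) h =
    (λ { refl → 1+n≢0 (trans (cong (_+ count z xs) (sym (δ-refl z))) h) })
    ∷ count≡0⇒All≢ z xs (m+n≡0⇒n≡0 (δ z x) h)

  All≢⇒count≡0 : ∀ {z xs} → All (z ≢_) xs → count z xs ≡ 0
  All≢⇒count≡0 []           = refl
  All≢⇒count≡0 (z≢x ∷ z≢xs) rewrite δ-≢ z≢x = All≢⇒count≡0 z≢xs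

  count-unique : ∀ {z xs} → Unique xs → z ∈ₗ xs → count z xs ≡ 1
  count-unique {z} (x≢xs ∷ _) (here refl) rewrite δ-refl z = cong suc (All≢⇒count≡0 x≢xs)
  count-unique (x≢xs ∷ u) (there z∈xs) rewrite δ-≢ (≢-sym (All.lookup x≢xs z∈xs)) = count-unique u z∈xs

  Path : (A → A) → A → List A → A → Set
  Path φ x []       y = φ x ≡ y
  Path φ x (w ∷ ws) y = φ x ≡ w × Path φ w ws y

  path-++ : ∀ {φ x y z} P {Q} → Path φ x P y → Path φ y Q z → Path φ x (P ++ y ∷ Q) z
  path-++ []      x→y        y→z = x→y , y→z
  path-++ (w ∷ P) (x→w , p) y→z = x→w , path-++ P p y→z

  path-split : ∀ {φ x y z} P {Q} → Path φ x (P ++ y ∷ Q) z → Path φ x P y × Path φ y Q z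
  path-split []      (x→y , q) = x→y , q
  path-split (w ∷ P) (x→w , p) with path-split P p
  ... | w→y , y→z = (x→w , w→y) , y→z

  path-cong : ∀ {φ φ′ x x′ y} W → Path φ x W y → All (λ w → φ′ w ≡ φ w) W → φ′ x′ ≡ φ x → Path φ′ x′ W y
  path-cong []      x→y       []       e = trans e x→y
  path-cong (w ∷ W) (x→w , p) (a ∷ as) e = trans e x→w , path-cong W p as a

  path-reaches : ∀ {φ x y z} W → Path φ x W y → z ∈ₗ x ∷ W → ∃[ k ] iter k φ x ≡ z
  path-reaches W       _         (here refl) = 0 , refl
  path-reaches {φ} {x} (w ∷ W) (refl , p) (there z∈W) with path-reaches W p z∈W
  ... | k , e = suc k , trans (sym (iter-commute {f = φ} {F = φ} φ (λ _ → refl) k x)) e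

  -- The orbit of h under φ, listed as h ∷ rest, passing through each z exactly μ z times.
  record Cycle (φ : A → A) (μ : A → ℕ) (h : A) : Set where
    constructor cycle
    field
      rest   : List A
      closed : Path φ h rest h
      counts : ∀ z → count z (h ∷ rest) ≡ μ z

  cycle-start : ∀ {φ μ h} → Cycle φ μ h → 1 ≤ μ h
  cycle-start {h = h} (cycle W _ counts) = subst (1 ≤_) (counts h) (∈⇒count {xs = h ∷ W} (here refl))

  cycle-reaches : ∀ {φ μ h z} → Cycle φ μ h → 1 ≤ μ z → ∃[ k ] iter k φ h ≡ z
  cycle-reaches {h = h} {z} (cycle W closed counts) z∈ =
    path-reaches W closed (count⇒∈ (h ∷ W) (subst (1 ≤_) (sym (counts z)) z∈))

  cycle-cong : ∀ {φ φ′ μ μ′ h} → (∀ x → φ′ x ≡ φ x) → (∀ z → μ z ≡ μ′ z) → Cycle φ μ h → Cycle φ′ μ′ h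
  cycle-cong φ′≗φ μ≗μ′ (cycle W closed counts) =
    cycle W (path-cong W closed (All.universal φ′≗φ W) (φ′≗φ _)) (λ z → trans (counts z) (μ≗μ′ z))

  cycle-rotate : ∀ {φ μ h f} → Cycle φ μ h → 1 ≤ μ f → Cycle φ μ f
  cycle-rotate {h = h} {f} (cycle W closed counts) f∈
    with count⇒∈ (h ∷ W) (subst (1 ≤_) (sym (counts f)) f∈)
  ... | here refl = cycle W closed counts
  ... | there f∈W with ∈-∃++ f∈W
  ...   | P , Q , refl with path-split P closed
  ...     | h→f , f→h = cycle (Q ++ h ∷ P) (path-++ Q f→h h→f) (λ z → trans (rotated z) (counts z))
    where
      rotated : ∀ z → count z (f ∷ Q ++ h ∷ P) ≡ count z (h ∷ P ++ f ∷ Q)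
      rotated z rewrite count-++ z Q (h ∷ P) | count-++ z P (f ∷ Q) =
        swap (δ z f) (count z Q) (δ z h) (count z P)
        where
          swap : ∀ p q r s → p + (q + (r + s)) ≡ r + (s + (p + q))
          swap = solve-∀

  -- φ′ = φ ∘ (a b c)
  record Twist (φ φ′ : A → A) (a b c : A) : Set where
    field
      at-a      : φ′ a ≡ φ b
      at-b      : φ′ b ≡ φ c
      at-c      : φ′ c ≡ φ a
      elsewhere : ∀ {w} → w ≢ a → w ≢ b → w ≢ c → φ′ w ≡ φ w

  module _ {φ φ′ : A → A} {a b c : A} (t : Twist φ φ′ a b c) where
    open Twist t

    private
      agrees : ∀ {W} → All (a ≢_) W → All (b ≢_) W → All (c ≢_) W → All (λ w → φ′ w ≡ φ w) W
      agrees []         []         []         = []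
      agrees (a≢ ∷ as) (b≢ ∷ bs) (c≢ ∷ cs) = elsewhere (≢-sym a≢) (≢-sym b≢) (≢-sym c≢) ∷ agrees as bs cs

      avoids : ∀ {z} X Y Z → z ∈ₗ a ∷ b ∷ c ∷ [] → count z (a ∷ X ++ b ∷ Y ++ c ∷ Z) ≤ 1 →
               All (z ≢_) X × All (z ≢_) Y × All (z ≢_) Z
      avoids {z} X Y Z z∈ bound = count≡0⇒All≢ z X (m+n≡0⇒m≡0 (count z X) X+Y≡0)
                                , count≡0⇒All≢ z Y (m+n≡0⇒n≡0 (count z X) X+Y≡0)
                                , count≡0⇒All≢ z Z (m+n≡0⇒n≡0 (count z X + count z Y) rest≡0)
        where
          rest≡0 : count z X + count z Y + count z Z ≡ 0
          rest≡0 = n≤0⇒n≡0 (+-cancelˡ-≤ 1 _ 0 (≤-trans (+-monoˡ-≤ _ (∈⇒count z∈))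
                     (≤-trans (≤-reflexive (sym (count-segments z a b c X Y Z))) bound)))
          X+Y≡0 : count z X + count z Y ≡ 0
          X+Y≡0 = m+n≡0⇒m≡0 (count z X + count z Y) rest≡0

    twist-agrees : ∀ X Y Z → (∀ z → count z (a ∷ X ++ b ∷ Y ++ c ∷ Z) ≤ 1) →
                   All (λ w → φ′ w ≡ φ w) X × All (λ w → φ′ w ≡ φ w) Y × All (λ w → φ′ w ≡ φ w) Z
    twist-agrees X Y Z simple
      with avoids X Y Z (here refl) (simple a)
         | avoids X Y Z (there (here refl)) (simple b)
         | avoids X Y Z (there (there (here refl))) (simple c)
    ... | aX , aY , aZ | bX , bY , bZ | cX , cY , cZ = agrees aX bX cX , agrees aY bY cY , agrees aZ bZ cZ

  cycle-merge₃ : ∀ {φ φ′ μa μb μc a b c} → Cycle φ μa a → Cycle φ μb b → Cycle φ μc c →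
                 (∀ z → μa z + μb z + μc z ≤ 1) → Twist φ φ′ a b c →
                 Cycle φ′ (λ z → μa z + μb z + μc z) a
  cycle-merge₃ {μa = μa} {μb} {μc} {a} {b} {c} (cycle X pX cX) (cycle Y pY cY) (cycle Z pZ cZ) disjoint t =
    let agX , agY , agZ = twist-agrees t X Y Z (λ z → subst (_≤ 1) (sym (joint z)) (disjoint z)) in
    cycle (Y ++ b ∷ Z ++ c ∷ X)
          (path-++ Y (path-cong Y pY agY at-a) (path-++ Z (path-cong Z pZ agZ at-b) (path-cong X pX agX at-c)))
          (λ z → trans (merged z) (joint z))
    where
      open Twist t
      joint : ∀ z → count z (a ∷ X ++ b ∷ Y ++ c ∷ Z) ≡ μa z + μb z + μc z
      joint z rewrite count-++ z X (b ∷ Y ++ c ∷ Z) | count-++ z Y (c ∷ Z) | sym (cX z) | sym (cY z) | sym (cZ z) =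
        regroup (δ z a) (count z X) (δ z b) (count z Y) (δ z c) (count z Z)
        where
          regroup : ∀ p x q y r w → p + (x + (q + (y + (r + w)))) ≡ p + x + (q + y) + (r + w)
          regroup = solve-∀
      merged : ∀ z → count z (a ∷ Y ++ b ∷ Z ++ c ∷ X) ≡ count z (a ∷ X ++ b ∷ Y ++ c ∷ Z)
      merged z rewrite count-segments z a b c Y Z X | count-segments z a b c X Y Z =
        cong (count z (a ∷ b ∷ c ∷ []) +_) (rotate₃ (count z Y) (count z Z) (count z X))
        where
          rotate₃ : ∀ y w x → y + w + x ≡ x + y + w
          rotate₃ = solve-∀

  private
    twist-in-order : ∀ {φ φ′ μ a b c} X Y Z → Path φ a (X ++ b ∷ Y ++ c ∷ Z) a →
                     (∀ z → count z (a ∷ X ++ b ∷ Y ++ c ∷ Z) ≡ μ z) → (∀ z → μ z ≤ 1) →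
                     Twist φ φ′ a b c → Cycle φ′ μ a
    twist-in-order {μ = μ} {a} {b} {c} X Y Z closed counts simple t
      with path-split X closed
    ... | a→b , b→a with path-split Y b→a
    ... | b→c , c→a with twist-agrees t X Y Z (λ z → subst (_≤ 1) (sym (counts z)) (simple z))
    ... | agX , agY , agZ =
      cycle (Y ++ c ∷ X ++ b ∷ Z)
            (path-++ Y (path-cong Y b→c agY at-a) (path-++ X (path-cong X a→b agX at-c) (path-cong Z c→a agZ at-b)))
            (λ z → trans (reordered z) (counts z))
      where
        open Twist t
        reordered : ∀ z → count z (a ∷ Y ++ c ∷ X ++ b ∷ Z) ≡ count z (a ∷ X ++ b ∷ Y ++ c ∷ Z)
        reordered z rewrite count-segments z a c b Y X Z | count-segments z a b c X Y Z =
          regroup (δ z a) (δ z b) (δ z c) (count z X) (count z Y) (count z Z)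
          where
            regroup : ∀ p q r x y w → p + (r + (q + 0)) + (y + x + w) ≡ p + (q + (r + 0)) + (x + y + w)
            regroup = solve-∀

  cycle-rest-∈ : ∀ {φ μ h z} (C : Cycle φ μ h) → 1 ≤ μ z → h ≢ z → z ∈ₗ Cycle.rest C
  cycle-rest-∈ {h = h} {z} (cycle W _ counts) z∈ h≢z with count⇒∈ (h ∷ W) (subst (1 ≤_) (sym (counts z)) z∈)
  ... | here z≡h  = contradiction (sym z≡h) h≢z
  ... | there z∈W = z∈W

  -- Which of the two orientations works depends on the order in which b and c occur on the cycle.
  cycle-twist : ∀ {φ φ⁺ φ⁻ μ a b c} → Cycle φ μ a → (∀ z → μ z ≤ 1) → 1 ≤ μ b → 1 ≤ μ c →
                a ≢ b → a ≢ c → b ≢ c → Twist φ φ⁺ a b c → Twist φ φ⁻ a c b →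
                Cycle φ⁺ μ a ⊎ Cycle φ⁻ μ a
  cycle-twist {a = a} {b} {c} C@(cycle W closed counts) simple b∈ c∈ a≢b a≢c b≢c t⁺ t⁻
    with ∈-∃++ (cycle-rest-∈ C b∈ a≢b)
  ... | P , Q , refl with ∈-++⁻ P (cycle-rest-∈ C c∈ a≢c)
  ... | inj₂ (here c≡b)  = contradiction (sym c≡b) b≢c
  ... | inj₂ (there c∈Q) with ∈-∃++ c∈Q
  ...   | Q₁ , Q₂ , refl = inj₁ (twist-in-order P Q₁ Q₂ closed counts simple t⁺)
  cycle-twist {a = a} {b} {c} (cycle W closed counts) simple b∈ c∈ a≢b a≢c b≢c t⁺ t⁻
      | P , Q , refl | inj₁ c∈P with ∈-∃++ c∈P
  ... | P₁ , P₂ , refl =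
    inj₂ (twist-in-order P₁ P₂ Q (subst (λ L → Path _ a L a) reassoc closed)
                         (λ z → trans (cong (λ L → count z (a ∷ L)) (sym reassoc)) (counts z)) simple t⁻)
    where
      reassoc : (P₁ ++ c ∷ P₂) ++ b ∷ Q ≡ P₁ ++ c ∷ P₂ ++ b ∷ Q
      reassoc = ++-assoc P₁ (c ∷ P₂) (b ∷ Q)

insert : ∀ {n} → Fin n → Subset n → Subset n
insert x p = p [ x ]≔ inside

x∈insert : ∀ {n} x (p : Subset n) → x ∈ insert x p
x∈insert x p = []≔-updates p x

⊆-insert : ∀ {n} x (p : Subset n) → p ⊆ insert x p
⊆-insert x p {y} y∈p with y ≟ x
... | yes refl = x∈insert x p
... | no y≢x   = []≔-minimal p y x y≢x y∈p

∈-insert⁻ : ∀ {n x y} (p : Subset n) → y ∈ insert x p → y ≡ x ⊎ y ∈ p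
∈-insert⁻ {x = x} {y} p y∈ with y ≟ x
... | yes y≡x = inj₁ y≡x
... | no  y≢x = inj₂ (lookup⇒[]= y p (trans (sym (lookup∘update′ y≢x p inside)) ([]=⇒lookup y∈)))

insert-⊆ : ∀ {n x} {p q : Subset n} → x ∈ q → p ⊆ q → insert x p ⊆ q
insert-⊆ {p = p} x∈q p⊆q y∈ with ∈-insert⁻ p y∈
... | inj₁ refl = x∈q
... | inj₂ y∈p  = p⊆q y∈p

∣insert∣-∈ : ∀ {n x} (p : Subset n) → x ∈ p → ∣ insert x p ∣ ≡ ∣ p ∣
∣insert∣-∈ {x = x} p x∈p = cong ∣_∣ (trans (cong (p [ x ]≔_) (sym ([]=⇒lookup x∈p))) ([]≔-lookup p x))

∣insert∣-∉ : ∀ {n x} (p : Subset n) → x ∉ p → ∣ insert x p ∣ ≡ suc ∣ p ∣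
∣insert∣-∉ {x = zero}  (inside  ∷ p) x∉p = contradiction here x∉p
∣insert∣-∉ {x = zero}  (outside ∷ p) x∉p = refl
∣insert∣-∉ {x = suc x} (inside  ∷ p) x∉p = cong suc (∣insert∣-∉ p (x∉p ∘ there))
∣insert∣-∉ {x = suc x} (outside ∷ p) x∉p = ∣insert∣-∉ p (x∉p ∘ there)

∣insert∣≤ : ∀ {n} x (p : Subset n) → ∣ insert x p ∣ ≤ suc ∣ p ∣
∣insert∣≤ x p with x ∈? p
... | yes x∈p = ≤-trans (≤-reflexive (∣insert∣-∈ p x∈p)) (n≤1+n _)
... | no  x∉p = ≤-reflexive (∣insert∣-∉ p x∉p)

elements : ∀ {n} → Subset n → List (Fin n)
elements []            = []
elements (inside  ∷ p) = zero ∷ map suc (elements p)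
elements (outside ∷ p) = map suc (elements p)

length-elements : ∀ {n} (p : Subset n) → length (elements p) ≡ ∣ p ∣
length-elements []            = refl
length-elements (inside  ∷ p) = cong suc (trans (length-map suc (elements p)) (length-elements p))
length-elements (outside ∷ p) = trans (length-map suc (elements p)) (length-elements p)

∈-elements⁺ : ∀ {n x} {p : Subset n} → x ∈ p → x ∈ₗ elements p
∈-elements⁺ {p = inside  ∷ p} here          = here refl
∈-elements⁺ {p = inside  ∷ p} (there x∈p)   = there (∈-map⁺ suc (∈-elements⁺ x∈p))
∈-elements⁺ {p = outside ∷ p} (there x∈p)   = ∈-map⁺ suc (∈-elements⁺ x∈p)

∈-elements⁻ : ∀ {n x} (p : Subset n) → x ∈ₗ elements p → x ∈ p
∈-elements⁻ (inside ∷ p) (here refl) = here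
∈-elements⁻ (inside ∷ p) (there x∈) with ∈-map⁻ suc x∈
... | y , y∈ , refl = there (∈-elements⁻ p y∈)
∈-elements⁻ (outside ∷ p) x∈ with ∈-map⁻ suc x∈
... | y , y∈ , refl = there (∈-elements⁻ p y∈)

elements-unique : ∀ {n} (p : Subset n) → Unique (elements p)
elements-unique []            = []
elements-unique (inside  ∷ p) =
  All.map⁺ (All.universal (λ _ ()) (elements p)) ∷ Unique.map⁺ fsuc-injective (elements-unique p)
elements-unique (outside ∷ p) = Unique.map⁺ fsuc-injective (elements-unique p)

record ThreeElements {n} (p : Subset n) : Set where
  field
    element   : Fin 3 → Fin n
    injective : Injective _≡_ _≡_ element
    ∈p        : ∀ k → element k ∈ p
    complete  : ∀ {x} → x ∈ p → ∃[ k ] element k ≡ x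

three-elements : ∀ {n} (p : Subset n) → ∣ p ∣ ≡ 3 → ThreeElements p
three-elements p ∣p∣≡3
  with elements p | trans (length-elements p) ∣p∣≡3 | (λ {x} → ∈-elements⁺ {x = x} {p}) | (λ {x} → ∈-elements⁻ {x = x} p)
     | elements-unique p
... | a ∷ b ∷ c ∷ [] | _ | complete | sound | (a≢b ∷ a≢c ∷ []) ∷ (b≢c ∷ []) ∷ _ = record
  { element   = element
  ; injective = injective
  ; ∈p        = λ k → sound (∈-element k)
  ; complete  = λ x∈p → index (complete x∈p)
  }
  where
    element : Fin 3 → _
    element zero             = a
    element (suc zero)       = b
    element (suc (suc zero)) = c
    ∈-element : ∀ k → element k ∈ₗ a ∷ b ∷ c ∷ []
    ∈-element zero             = here refl
    ∈-element (suc zero)       = there (here refl)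
    ∈-element (suc (suc zero)) = there (there (here refl))
    index : ∀ {x} → x ∈ₗ a ∷ b ∷ c ∷ [] → ∃[ k ] element k ≡ x
    index (here refl)                 = zero , refl
    index (there (here refl))         = suc zero , refl
    index (there (there (here refl))) = suc (suc zero) , refl
    injective : Injective _≡_ _≡_ element
    injective {zero}           {zero}           _ = refl
    injective {zero}           {suc zero}       e = contradiction e a≢b
    injective {zero}           {suc (suc zero)} e = contradiction e a≢c
    injective {suc zero}       {zero}           e = contradiction (sym e) a≢b
    injective {suc zero}       {suc zero}       _ = refl
    injective {suc zero}       {suc (suc zero)} e = contradiction e b≢c
    injective {suc (suc zero)} {zero}           e = contradiction (sym e) a≢c
    injective {suc (suc zero)} {suc zero}       e = contradiction (sym e) b≢c
    injective {suc (suc zero)} {suc (suc zero)} _ = refl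
... | [] | () | _ | _ | _
... | _ ∷ [] | () | _ | _ | _
... | _ ∷ _ ∷ [] | () | _ | _ | _
... | _ ∷ _ ∷ _ ∷ _ ∷ _ | () | _ | _ | _

succ3-cube : ∀ d i → succ3 d (succ3 d (succ3 d i)) ≡ i
succ3-cube true  zero             = refl
succ3-cube true  (suc zero)       = refl
succ3-cube true  (suc (suc zero)) = refl
succ3-cube false zero             = refl
succ3-cube false (suc zero)       = refl
succ3-cube false (suc (suc zero)) = refl

succ3-≢ : ∀ d i → succ3 d i ≢ i
succ3-≢ true  zero             ()
succ3-≢ true  (suc zero)       ()
succ3-≢ true  (suc (suc zero)) ()
succ3-≢ false zero             ()
succ3-≢ false (suc zero)       ()
succ3-≢ false (suc (suc zero)) ()

succ3²-≢ : ∀ d i → succ3 d (succ3 d i) ≢ i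
succ3²-≢ d i e = succ3-≢ d (succ3 d (succ3 d i)) (trans (succ3-cube d i) (sym e))

succ3-orbit : ∀ d i j → j ≡ i ⊎ j ≡ succ3 d i ⊎ j ≡ succ3 d (succ3 d i)
succ3-orbit true  zero             zero             = inj₁ refl
succ3-orbit true  zero             (suc zero)       = inj₂ (inj₁ refl)
succ3-orbit true  zero             (suc (suc zero)) = inj₂ (inj₂ refl)
succ3-orbit true  (suc zero)       zero             = inj₂ (inj₂ refl)
succ3-orbit true  (suc zero)       (suc zero)       = inj₁ refl
succ3-orbit true  (suc zero)       (suc (suc zero)) = inj₂ (inj₁ refl)
succ3-orbit true  (suc (suc zero)) zero             = inj₂ (inj₁ refl)
succ3-orbit true  (suc (suc zero)) (suc zero)       = inj₂ (inj₂ refl)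
succ3-orbit true  (suc (suc zero)) (suc (suc zero)) = inj₁ refl
succ3-orbit false zero             zero             = inj₁ refl
succ3-orbit false zero             (suc zero)       = inj₂ (inj₂ refl)
succ3-orbit false zero             (suc (suc zero)) = inj₂ (inj₁ refl)
succ3-orbit false (suc zero)       zero             = inj₂ (inj₁ refl)
succ3-orbit false (suc zero)       (suc zero)       = inj₁ refl
succ3-orbit false (suc zero)       (suc (suc zero)) = inj₂ (inj₂ refl)
succ3-orbit false (suc (suc zero)) zero             = inj₂ (inj₂ refl)
succ3-orbit false (suc (suc zero)) (suc zero)       = inj₂ (inj₁ refl)
succ3-orbit false (suc (suc zero)) (suc (suc zero)) = inj₁ refl

data OddOneOut (P : Fin 3 → Set) : Set where
  all-in   : (∀ k → P k) → OddOneOut P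
  all-out  : (∀ k → ¬ P k) → OddOneOut P
  lone-in  : ∀ k → P k → ¬ P (succ3 true k) → ¬ P (succ3 true (succ3 true k)) → OddOneOut P
  lone-out : ∀ k → ¬ P k → P (succ3 true k) → P (succ3 true (succ3 true k)) → OddOneOut P

odd-one-out : ∀ {P : Fin 3 → Set} → (∀ k → Dec (P k)) → OddOneOut P
odd-one-out P? with P? zero | P? (suc zero) | P? (suc (suc zero))
... | yes p₀ | yes p₁ | yes p₂ = all-in λ { zero → p₀ ; (suc zero) → p₁ ; (suc (suc zero)) → p₂ }
... | no ¬p₀ | no ¬p₁ | no ¬p₂ = all-out λ { zero → ¬p₀ ; (suc zero) → ¬p₁ ; (suc (suc zero)) → ¬p₂ }
... | yes p₀ | no ¬p₁ | no ¬p₂ = lone-in zero p₀ ¬p₁ ¬p₂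
... | no ¬p₀ | yes p₁ | no ¬p₂ = lone-in (suc zero) p₁ ¬p₂ ¬p₀
... | no ¬p₀ | no ¬p₁ | yes p₂ = lone-in (suc (suc zero)) p₂ ¬p₀ ¬p₁
... | no ¬p₀ | yes p₁ | yes p₂ = lone-out zero ¬p₀ p₁ p₂
... | yes p₀ | no ¬p₁ | yes p₂ = lone-out (suc zero) ¬p₁ p₂ p₀
... | yes p₀ | yes p₁ | no ¬p₂ = lone-out (suc (suc zero)) ¬p₂ p₀ p₁

module Configuration {v : ℕ} (X : SymConfig v) where
  open SymConfig X

  infix 4 _∈ᴮ_ _∈ᴮ?_
  _∈ᴮ_ : Fin v → Fin v → Set
  _∈ᴮ_ = _∈ᵇ_ blk

  _∈ᴮ?_ : ∀ x b → Dec (x ∈ᴮ b)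
  x ∈ᴮ? b = any? (λ i → blk b i ≟ x)

  ∈-blocksThrough⁻ : ∀ {x b} → b ∈ blocksThrough blk x → x ∈ᴮ b
  ∈-blocksThrough⁻ {x} {b} b∈ =
    invert (subst (Reflects _) (trans (sym (lookup∘tabulate _ b)) ([]=⇒lookup b∈)) (proof (x ∈ᴮ? b)))

  ∈-blocksThrough⁺ : ∀ {x b} → x ∈ᴮ b → b ∈ blocksThrough blk x
  ∈-blocksThrough⁺ {x} {b} x∈b =
    lookup⇒[]= b _ (trans (lookup∘tabulate _ b) (dec-true (x ∈ᴮ? b) x∈b))

  private opaque
    through : ∀ x → ThreeElements (blocksThrough blk x)
    through x = three-elements (blocksThrough blk x) (regular x)

  blockAt : Fin v → Fin 3 → Fin v
  blockAt x = ThreeElements.element (through x)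

  blockAt-injective : ∀ x → Injective _≡_ _≡_ (blockAt x)
  blockAt-injective x = ThreeElements.injective (through x)

  ∈-blockAt : ∀ x k → x ∈ᴮ blockAt x k
  ∈-blockAt x k = ∈-blocksThrough⁻ (ThreeElements.∈p (through x) k)

  blockAt-complete : ∀ {x b} → x ∈ᴮ b → ∃[ k ] blockAt x k ≡ b
  blockAt-complete {x} x∈b = ThreeElements.complete (through x) (∈-blocksThrough⁺ x∈b)

  blockAt-all∈ : ∀ {x M} k → blockAt x k ∈ M → blockAt x (succ3 true k) ∈ M →
                 blockAt x (succ3 true (succ3 true k)) ∈ M → ∀ j → blockAt x j ∈ M
  blockAt-all∈ k p₀ p₁ p₂ j with succ3-orbit true k j
  ... | inj₁ refl        = p₀
  ... | inj₂ (inj₁ refl) = p₁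
  ... | inj₂ (inj₂ refl) = p₂

  -- (b , i) is the occurrence of the point blk b i in the block b.
  Flag : Set
  Flag = Fin v × Fin 3

  point : Flag → Fin v
  point (b , i) = blk b i

  flag-ext : ∀ {f g : Flag} → proj₁ f ≡ proj₁ g → point f ≡ point g → f ≡ g
  flag-ext {b , i} {.b , j} refl e = cong (b ,_) (distinct b e)

  flagAt : Fin v → Fin 3 → Flag
  flagAt x k = blockAt x k , proj₁ (∈-blockAt x k)

  point-flagAt : ∀ x k → point (flagAt x k) ≡ x
  point-flagAt x k = proj₂ (∈-blockAt x k)

  opaque
    flagIndex : Flag → Fin 3
    flagIndex (b , i) = proj₁ (blockAt-complete {b = b} (i , refl))

    blockAt-flagIndex : ∀ f → blockAt (point f) (flagIndex f) ≡ proj₁ f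
    blockAt-flagIndex (b , i) = proj₂ (blockAt-complete {b = b} (i , refl))

  flagAt-flagIndex : ∀ f → flagAt (point f) (flagIndex f) ≡ f
  flagAt-flagIndex f = flag-ext (blockAt-flagIndex f) (point-flagAt (point f) (flagIndex f))

  flagIndex-flagAt : ∀ x k → flagIndex (flagAt x k) ≡ k
  flagIndex-flagAt x k = blockAt-injective x
    (subst (λ y → blockAt y (flagIndex (flagAt x k)) ≡ blockAt x k) (point-flagAt x k) (blockAt-flagIndex (flagAt x k)))

  flagAt-≢ : ∀ x {k k′} → k ≢ k′ → flagAt x k ≢ flagAt x k′
  flagAt-≢ x k≢k′ e = k≢k′ (blockAt-injective x (cong proj₁ e))

  σ : Bool → Flag → Flag
  σ d f = flagAt (point f) (succ3 d (flagIndex f))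

  point-σ : ∀ d f → point (σ d f) ≡ point f
  point-σ d f = point-flagAt (point f) _

  σ-flagAt : ∀ d x k → σ d (flagAt x k) ≡ flagAt x (succ3 d k)
  σ-flagAt d x k = cong₂ (λ y j → flagAt y (succ3 d j)) (point-flagAt x k) (flagIndex-flagAt x k)

  flags-at : ∀ {f x} → point f ≡ x → ∀ d k →
                  f ≡ flagAt x k ⊎ f ≡ flagAt x (succ3 d k) ⊎ f ≡ flagAt x (succ3 d (succ3 d k))
  flags-at {f} refl d k with succ3-orbit d k (flagIndex f)
  ... | inj₁ e         = inj₁ (trans (sym (flagAt-flagIndex f)) (cong (flagAt (point f)) e))
  ... | inj₂ (inj₁ e)  = inj₂ (inj₁ (trans (sym (flagAt-flagIndex f)) (cong (flagAt (point f)) e)))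
  ... | inj₂ (inj₂ e)  = inj₂ (inj₂ (trans (sym (flagAt-flagIndex f)) (cong (flagAt (point f)) e)))

  _≟ᶠ_ : DecidableEquality Flag
  _≟ᶠ_ = ≡-dec _≟_ _≟_

  open Cycles _≟ᶠ_ public

  BlocksThrough_⊆_ : Subset v → Subset v → Set
  BlocksThrough U ⊆ M = ∀ {x b} → x ∈ U → x ∈ᴮ b → b ∈ M

  BlocksThrough-insert : ∀ {U M M′ x} → BlocksThrough U ⊆ M → M ⊆ M′ → (∀ k → blockAt x k ∈ M′) →
                         BlocksThrough insert x U ⊆ M′
  BlocksThrough-insert {U} closed M⊆M′ at-x y∈ y∈b with ∈-insert⁻ U y∈
  ... | inj₂ y∈U  = M⊆M′ (closed y∈U y∈b)
  ... | inj₁ refl with blockAt-complete y∈b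
  ...   | k , refl = at-x k

  withBlocksAt : Fin v → Subset v → Subset v
  withBlocksAt x M = insert (blockAt x zero) (insert (blockAt x (suc zero)) (insert (blockAt x (suc (suc zero))) M))

  ⊆-withBlocksAt : ∀ x M → M ⊆ withBlocksAt x M
  ⊆-withBlocksAt x M = ⊆-insert _ _ ∘ ⊆-insert _ _ ∘ ⊆-insert _ M

  blockAt∈withBlocksAt : ∀ x M k → blockAt x k ∈ withBlocksAt x M
  blockAt∈withBlocksAt x M zero             = x∈insert _ _
  blockAt∈withBlocksAt x M (suc zero)       = ⊆-insert _ _ (x∈insert _ _)
  blockAt∈withBlocksAt x M (suc (suc zero)) = ⊆-insert _ _ (⊆-insert _ _ (x∈insert _ M))

  ∣withBlocksAt∣≤ : ∀ x M k → blockAt x k ∈ M → ∣ withBlocksAt x M ∣ ≤ 2 + ∣ M ∣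
  ∣withBlocksAt∣≤ x M = by-index
    where
      open ≤-Reasoning
      b₀ b₁ b₂ : Fin v
      b₀ = blockAt x zero
      b₁ = blockAt x (suc zero)
      b₂ = blockAt x (suc (suc zero))
      by-index : ∀ k → blockAt x k ∈ M → ∣ insert b₀ (insert b₁ (insert b₂ M)) ∣ ≤ 2 + ∣ M ∣
      by-index zero b₀∈M = begin
        ∣ insert b₀ (insert b₁ (insert b₂ M)) ∣ ≡⟨ ∣insert∣-∈ _ (⊆-insert b₁ _ (⊆-insert b₂ M b₀∈M)) ⟩
        ∣ insert b₁ (insert b₂ M) ∣            ≤⟨ ∣insert∣≤ b₁ (insert b₂ M) ⟩
        suc ∣ insert b₂ M ∣                    ≤⟨ s≤s (∣insert∣≤ b₂ M) ⟩
        2 + ∣ M ∣                              ∎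
      by-index (suc zero) b₁∈M = begin
        ∣ insert b₀ (insert b₁ (insert b₂ M)) ∣ ≤⟨ ∣insert∣≤ b₀ (insert b₁ (insert b₂ M)) ⟩
        suc ∣ insert b₁ (insert b₂ M) ∣        ≡⟨ cong suc (∣insert∣-∈ _ (⊆-insert b₂ M b₁∈M)) ⟩
        suc ∣ insert b₂ M ∣                    ≤⟨ s≤s (∣insert∣≤ b₂ M) ⟩
        2 + ∣ M ∣                              ∎
      by-index (suc (suc zero)) b₂∈M = begin
        ∣ insert b₀ (insert b₁ (insert b₂ M)) ∣ ≤⟨ ∣insert∣≤ b₀ (insert b₁ (insert b₂ M)) ⟩
        suc ∣ insert b₁ (insert b₂ M) ∣        ≤⟨ s≤s (∣insert∣≤ b₁ (insert b₂ M)) ⟩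
        2 + ∣ insert b₂ M ∣                    ≡⟨ cong (2 +_) (∣insert∣-∈ M b₂∈M) ⟩
        2 + ∣ M ∣                              ∎

  module Saturation (S : Subset v) (connected : InducedConnected blk S) where

    record Frontier (U M : Subset v) : Set where
      field
        pivot     : Fin v
        pivot∈S   : pivot ∈ S
        pivot∉U   : pivot ∉ U
        inner     : Fin v
        pivot∈inner : pivot ∈ᴮ inner
        inner∈M   : inner ∈ M
        outer     : Fin v
        pivot∈outer : pivot ∈ᴮ outer
        outer∉M   : outer ∉ M

    frontier : ∀ {U M b b′} → BlocksThrough U ⊆ M → b ∈ M → b′ ∉ M → Frontier U M
    frontier {U} {M} {b} {b′} closed b∈M b′∉M = walk b∈M (connected (inj₂ b) (inj₂ b′) tt tt)
      where
        walk : ∀ {c} → c ∈ M → Star (InducedAdj blk S) (inj₂ c) (inj₂ b′) → Frontier U M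
        walk c∈M ε = contradiction c∈M b′∉M
        walk c∈M (_◅_ {j = inj₂ _} (_ , _ , ()) _)
        walk c∈M (_◅_ {j = inj₁ _} _ (_◅_ {j = inj₁ _} (_ , _ , ()) _))
        walk {c} c∈M (_◅_ {j = inj₁ p} (_ , p∈S , p∈c) (_◅_ {j = inj₂ c′} (_ , _ , p∈c′) rest)) with c′ ∈? M
        ... | yes c′∈M = walk c′∈M rest
        ... | no  c′∉M = record
          { pivot = p ; pivot∈S = p∈S ; pivot∉U = λ p∈U → c′∉M (closed p∈U p∈c′)
          ; inner = c ; pivot∈inner = p∈c ; inner∈M = c∈M
          ; outer = c′ ; pivot∈outer = p∈c′ ; outer∉M = c′∉M }

    full-or-frontier : ∀ {U M b} → BlocksThrough U ⊆ M → b ∈ M → (∀ b → b ∈ M) ⊎ Frontier U M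
    full-or-frontier {M = M} closed b∈M with all? (_∈? M)
    ... | yes full = inj₁ full
    ... | no ¬full = let b′ , b′∉M = ¬∀⟶∃¬ v _ (_∈? M) ¬full in inj₂ (frontier closed b∈M b′∉M)

    module _ (∣S∣-half : suc (2 * ∣ S ∣) ≡ v) where

      -- Saturating (U, M) by frontier points reaches every block and costs at most two new blocks
      -- per point, so a pair with ∣ M ∣ ≤ 2 * ∣ U ∣ would give v ≤ 2 * ∣ S ∣ < v.
      private
        sparse-impossible : ∀ n {U M b} → ∣ U ∣ + n ≡ ∣ S ∣ → U ⊆ S → BlocksThrough U ⊆ M → b ∈ M →
                            ∣ M ∣ ≤ 2 * ∣ U ∣ → ⊥
        sparse-impossible n {U} {M} fuel U⊆S closed b∈M sparse with full-or-frontier closed b∈M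
        ... | inj₁ full = <-irrefl refl (begin-strict
          v                 ≡⟨ ∣⊤∣≡n v ⟨
          ∣ ⊤ {v} ∣         ≤⟨ p⊆q⇒∣p∣≤∣q∣ {p = ⊤} {M} (λ {x} _ → full x) ⟩
          ∣ M ∣             ≤⟨ sparse ⟩
          2 * ∣ U ∣         ≤⟨ *-monoʳ-≤ 2 (p⊆q⇒∣p∣≤∣q∣ U⊆S) ⟩
          2 * ∣ S ∣         <⟨ n<1+n _ ⟩
          suc (2 * ∣ S ∣)   ≡⟨ ∣S∣-half ⟩
          v                 ∎)
          where open ≤-Reasoning
        ... | inj₂ fr with n
        ...   | zero  = <-irrefl (trans (sym (+-identityʳ _)) fuel)
                          (p⊂q⇒∣p∣<∣q∣ (U⊆S , Frontier.pivot fr , Frontier.pivot∈S fr , Frontier.pivot∉U fr))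
        ...   | suc n = sparse-impossible n fuel′ (insert-⊆ pivot∈S U⊆S)
                          (BlocksThrough-insert closed (⊆-withBlocksAt pivot M) (blockAt∈withBlocksAt pivot M))
                          (⊆-withBlocksAt pivot M b∈M) sparse′
          where
            open Frontier fr
            ∣U′∣ : ∣ insert pivot U ∣ ≡ suc ∣ U ∣
            ∣U′∣ = ∣insert∣-∉ U pivot∉U
            fuel′ : ∣ insert pivot U ∣ + n ≡ ∣ S ∣
            fuel′ = trans (cong (_+ n) ∣U′∣) (trans (sym (+-suc _ n)) fuel)
            sparse′ : ∣ withBlocksAt pivot M ∣ ≤ 2 * ∣ insert pivot U ∣
            sparse′ = let k , k↦inner = blockAt-complete pivot∈inner in begin
              ∣ withBlocksAt pivot M ∣ ≤⟨ ∣withBlocksAt∣≤ pivot M k (subst (_∈ M) (sym k↦inner) inner∈M) ⟩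
              2 + ∣ M ∣               ≤⟨ +-monoʳ-≤ 2 sparse ⟩
              2 + 2 * ∣ U ∣           ≡⟨ *-suc 2 ∣ U ∣ ⟨
              2 * suc ∣ U ∣           ≡⟨ cong (2 *_) ∣U′∣ ⟨
              2 * ∣ insert pivot U ∣  ∎
              where open ≤-Reasoning

      2∣U∣<∣M∣ : ∀ {U M b} → U ⊆ S → BlocksThrough U ⊆ M → b ∈ M → 2 * ∣ U ∣ < ∣ M ∣
      2∣U∣<∣M∣ {U} U⊆S closed b∈M =
        ≰⇒> (sparse-impossible (∣ S ∣ ∸ ∣ U ∣) (m+[n∸m]≡n (p⊆q⇒∣p∣≤∣q∣ U⊆S)) U⊆S closed b∈M)

  -- The outer-face permutation

  module Oriented (o : Orientation v) where

    ρ : Flag → Flag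
    ρ (b , i) = b , succ3 (o b) (succ3 (o b) i)

    next prev : Flag → Fin v
    next (b , i) = blk b (succ3 (o b) i)
    prev f       = point (ρ f)

    ρ-cube : ∀ f → ρ (ρ (ρ f)) ≡ f
    ρ-cube (b , i) = cong (b ,_) (trans (cong (succ3 (o b) ∘ succ3 (o b)) (succ3-cube (o b) _)) (succ3-cube (o b) i))

    -- A flag f stands for the outer dart dart f defined below. Points outside A have no cyclic
    -- order of their blocks chosen yet; there σ is replaced by the identity.
    turn : Subset v → Vec Bool v → Flag → Flag
    turn A c f = if does (point f ∈? A) then σ (lookup c (point f)) f else f

    face : Subset v → Vec Bool v → Flag → Flag
    face A c f = ρ (turn A c f)

    face-inactive : ∀ {A} c f → point f ∉ A → face A c f ≡ ρ f
    face-inactive {A} c f x∉A rewrite dec-false (point f ∈? A) x∉A = refl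

    face-active : ∀ {A} c f → point f ∈ A → face A c f ≡ ρ (σ (lookup c (point f)) f)
    face-active {A} c f x∈A rewrite dec-true (point f ∈? A) x∈A = refl

    module _ {A : Subset v} {c : Vec Bool v} {x : Fin v} (x∉A : x ∉ A) (d : Bool) where

      face-insert-≢ : ∀ f → point f ≢ x → face (insert x A) (c [ x ]≔ d) f ≡ face A c f
      face-insert-≢ f y≢x = by-cases (point f ∈? A)
        where
          open ≡-Reasoning
          by-cases : Dec (point f ∈ A) → face (insert x A) (c [ x ]≔ d) f ≡ face A c f
          by-cases (yes y∈A) = begin
            face (insert x A) (c [ x ]≔ d) f          ≡⟨ face-active (c [ x ]≔ d) f (⊆-insert x A y∈A) ⟩
            ρ (σ (lookup (c [ x ]≔ d) (point f)) f)   ≡⟨ cong (λ e → ρ (σ e f)) (lookup∘update′ y≢x c d) ⟩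
            ρ (σ (lookup c (point f)) f)              ≡⟨ face-active c f y∈A ⟨
            face A c f                                ∎
          by-cases (no y∉A) = trans (face-inactive (c [ x ]≔ d) f y∉insert) (sym (face-inactive c f y∉A))
            where
              y∉insert : point f ∉ insert x A
              y∉insert y∈ with ∈-insert⁻ A y∈
              ... | inj₁ y≡x = y≢x y≡x
              ... | inj₂ y∈A = y∉A y∈A

      face-insert-flagAt : ∀ k → face (insert x A) (c [ x ]≔ d) (flagAt x k) ≡ face A c (flagAt x (succ3 d k))
      face-insert-flagAt k = begin
        face (insert x A) c′ g           ≡⟨ face-active c′ g (subst (_∈ insert x A) (sym g↦x) (x∈insert x A)) ⟩
        ρ (σ (lookup c′ (point g)) g)    ≡⟨ cong (λ y → ρ (σ (lookup c′ y) g)) g↦x ⟩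
        ρ (σ (lookup c′ x) g)            ≡⟨ cong (λ e → ρ (σ e g)) (lookup∘update x c d) ⟩
        ρ (σ d g)                        ≡⟨ cong ρ (σ-flagAt d x k) ⟩
        ρ (flagAt x (succ3 d k))         ≡⟨ face-inactive c _ (subst (_∉ A) (sym (point-flagAt x _)) x∉A) ⟨
        face A c (flagAt x (succ3 d k))  ∎
        where
          open ≡-Reasoning
          c′ : Vec Bool v
          c′ = c [ x ]≔ d
          g : Flag
          g = flagAt x k
          g↦x : point g ≡ x
          g↦x = point-flagAt x k

      twist-at : ∀ k → Twist (face A c) (face (insert x A) (c [ x ]≔ d))
                              (flagAt x k) (flagAt x (succ3 d k)) (flagAt x (succ3 d (succ3 d k)))
      twist-at k = record
        { at-a      = face-insert-flagAt k
        ; at-b      = face-insert-flagAt (succ3 d k)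
        ; at-c      = trans (face-insert-flagAt _) (cong (face A c ∘ flagAt x) (succ3-cube d k))
        ; elsewhere = λ {w} ≢a ≢b ≢c → face-insert-≢ w (λ w↦x → [ ≢a , [ ≢b , ≢c ]′ ]′ (flags-at w↦x d k))
        }

    ρ-≢ : ∀ f → ρ f ≢ f
    ρ-≢ (b , i) e = succ3²-≢ (o b) i (cong proj₂ e)

    ρ²-≢ : ∀ f → ρ (ρ f) ≢ f
    ρ²-≢ f e = ρ-≢ (ρ (ρ f)) (trans (ρ-cube f) (sym e))

    ρ-orbit : ∀ {z f} → proj₁ z ≡ proj₁ f → z ≡ f ⊎ z ≡ ρ f ⊎ z ≡ ρ (ρ f)
    ρ-orbit {b , j} {.b , i} refl with succ3-orbit (o b) i j
    ... | inj₁ j≡i       = inj₁ (cong (b ,_) j≡i)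
    ... | inj₂ (inj₁ j≡) = inj₂ (inj₂ (cong (b ,_) (trans j≡ (sym (succ3-cube (o b) (succ3 (o b) i))))))
    ... | inj₂ (inj₂ j≡) = inj₂ (inj₁ (cong (b ,_) j≡))

    onBlocks : Subset v → Flag → ℕ
    onBlocks M f = if does (proj₁ f ∈? M) then 1 else 0

    onBlocks-∈ : ∀ {M} f → proj₁ f ∈ M → onBlocks M f ≡ 1
    onBlocks-∈ {M} f b∈M rewrite dec-true (proj₁ f ∈? M) b∈M = refl

    onBlocks-∉ : ∀ {M} f → proj₁ f ∉ M → onBlocks M f ≡ 0
    onBlocks-∉ {M} f b∉M rewrite dec-false (proj₁ f ∈? M) b∉M = refl

    onBlocks≤1 : ∀ M f → onBlocks M f ≤ 1
    onBlocks≤1 M f with does (proj₁ f ∈? M)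
    ... | true  = s≤s z≤n
    ... | false = z≤n

    onBlocks-pos : ∀ {M} f → 1 ≤ onBlocks M f → proj₁ f ∈ M
    onBlocks-pos {M} f pos with proj₁ f ∈? M
    ... | yes b∈M = b∈M
    ... | no  _   = contradiction pos λ ()

    onBlocks-insert : ∀ {B M} f → B ∉ M → onBlocks M f + onBlocks ⁅ B ⁆ f ≡ onBlocks (insert B M) f
    onBlocks-insert {B} {M} f B∉M = by-cases (proj₁ f ∈? M) (proj₁ f ≟ B)
      where
        by-cases : Dec (proj₁ f ∈ M) → Dec (proj₁ f ≡ B) → onBlocks M f + onBlocks ⁅ B ⁆ f ≡ onBlocks (insert B M) f
        by-cases (yes b∈M) _ =
          trans (cong₂ _+_ (onBlocks-∈ f b∈M) (onBlocks-∉ f (x≢y⇒x∉⁅y⁆ λ { refl → B∉M b∈M })))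
                (sym (onBlocks-∈ f (⊆-insert B M b∈M)))
        by-cases (no b∉M) (yes refl) =
          trans (cong₂ _+_ (onBlocks-∉ f b∉M) (onBlocks-∈ f (x∈⁅x⁆ B))) (sym (onBlocks-∈ f (x∈insert B M)))
        by-cases (no b∉M) (no b≢B) =
          trans (cong₂ _+_ (onBlocks-∉ f b∉M) (onBlocks-∉ f (x≢y⇒x∉⁅y⁆ b≢B)))
                (sym (onBlocks-∉ f ([ b≢B , b∉M ]′ ∘ ∈-insert⁻ M)))

    block-cycle : ∀ {A} c f → (∀ j → blk (proj₁ f) j ∉ A) → Cycle (face A c) (onBlocks ⁅ proj₁ f ⁆) f
    block-cycle c f inactive = cycle (ρ f ∷ ρ (ρ f) ∷ [])
      ( face-inactive c f (inactive _)
      , face-inactive c (ρ f) (inactive _)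
      , trans (face-inactive c (ρ (ρ f)) (inactive _)) (ρ-cube f))
      (λ z → by-cases z (proj₁ z ≟ proj₁ f))
      where
        unique : Unique (f ∷ ρ f ∷ ρ (ρ f) ∷ [])
        unique = (≢-sym (ρ-≢ f) ∷ ≢-sym (ρ²-≢ f) ∷ []) ∷ (≢-sym (ρ-≢ (ρ f)) ∷ []) ∷ [] ∷ []
        by-cases : ∀ z → Dec (proj₁ z ≡ proj₁ f) → count z (f ∷ ρ f ∷ ρ (ρ f) ∷ []) ≡ onBlocks ⁅ proj₁ f ⁆ z
        by-cases z (yes same) = trans (count-unique unique (member (ρ-orbit same)))
                                      (sym (onBlocks-∈ z (subst (_∈ ⁅ proj₁ f ⁆) (sym same) (x∈⁅x⁆ _))))
          where
            member : z ≡ f ⊎ z ≡ ρ f ⊎ z ≡ ρ (ρ f) → z ∈ₗ f ∷ ρ f ∷ ρ (ρ f) ∷ []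
            member (inj₁ refl)        = here refl
            member (inj₂ (inj₁ refl)) = there (here refl)
            member (inj₂ (inj₂ refl)) = there (there (here refl))
        by-cases z (no differ) = trans (All≢⇒count≡0 (off f refl ∷ off (ρ f) refl ∷ off (ρ (ρ f)) refl ∷ []))
                                       (sym (onBlocks-∉ z (x≢y⇒x∉⁅y⁆ differ)))
          where
            off : ∀ g → proj₁ g ≡ proj₁ f → z ≢ g
            off g same refl = differ same

    -- Rotation system and upper embedding

    point≢next : ∀ f → point f ≢ next f
    point≢next (b , i) e = succ3-≢ (o b) i (sym (distinct b e))

    point≢prev : ∀ f → point f ≢ prev f
    point≢prev (b , i) e = succ3²-≢ (o b) i (sym (distinct b e))

    next≢prev : ∀ f → next f ≢ prev f
    next≢prev (b , i) e = succ3-≢ (o b) (succ3 (o b) i) (sym (distinct b e))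

    next-ρ : ∀ f → next (ρ f) ≡ point f
    next-ρ (b , i) = cong (blk b) (succ3-cube (o b) i)

    adjacent-next : ∀ {u} f → point f ≡ u → KAdj blk u (next f)
    adjacent-next (b , i) refl = point≢next (b , i) , b , (i , refl) , (_ , refl)

    adjacent-prev : ∀ {u} f → point f ≡ u → KAdj blk u (prev f)
    adjacent-prev (b , i) refl = point≢prev (b , i) , b , (i , refl) , (_ , refl)

    neighbour : ∀ {u w} → KAdj blk u w → ∃[ f ] (point f ≡ u × (w ≡ prev f ⊎ w ≡ next f))
    neighbour (u≢w , b , (i , refl) , (j , refl)) with succ3-orbit (o b) i j
    ... | inj₁ refl           = contradiction refl u≢w
    ... | inj₂ (inj₁ j≡next)  = (b , i) , refl , inj₂ (cong (blk b) j≡next)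
    ... | inj₂ (inj₂ j≡prev)  = (b , i) , refl , inj₁ (cong (blk b) j≡prev)

    -- Around u, the rotation lists the two other points of each block through u (first prev, then
    -- next), taking the blocks through u in the cyclic order chosen by σ at u.
    rotate-in : Vec Bool v → ∀ u w → Dec (∃[ b ] (u ∈ᴮ b × w ∈ᴮ b)) → Fin v
    rotate-in c u w (yes (b , (i , _) , _)) =
      if does (next (b , i) ≟ w) then prev (σ (lookup c u) (b , i)) else next (b , i)
    rotate-in c u w (no _) = w

    rotation : Vec Bool v → Fin v → Fin v → Fin v
    rotation c u w = rotate-in c u w (any? (λ b → (u ∈ᴮ? b) ×-dec (w ∈ᴮ? b)))

    rotation-prev : ∀ c {u} f → point f ≡ u → rotation c u (prev f) ≡ next f
    rotation-prev c (b , i) refl = go (any? _)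
      where
        go : ∀ d → rotate-in c (blk b i) (prev (b , i)) d ≡ next (b , i)
        go (no ∄) = contradiction (b , (i , refl) , (_ , refl)) ∄
        go (yes (b′ , (i′ , e) , w∈b′))
          with linear _ _ b′ b (point≢prev (b , i)) (i′ , e) w∈b′ (i , refl) (_ , refl)
        ... | refl with distinct b e
        ... | refl rewrite dec-false (next (b , i) ≟ prev (b , i)) (next≢prev (b , i)) = refl

    rotation-next : ∀ c {u} f → point f ≡ u → rotation c u (next f) ≡ prev (σ (lookup c u) f)
    rotation-next c (b , i) refl = go (any? _)
      where
        go : ∀ d → rotate-in c (blk b i) (next (b , i)) d ≡ prev (σ (lookup c (blk b i)) (b , i))
        go (no ∄) = contradiction (b , (i , refl) , (_ , refl)) ∄
        go (yes (b′ , (i′ , e) , w∈b′))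
          with linear _ _ b′ b (point≢next (b , i)) (i′ , e) w∈b′ (i , refl) (_ , refl)
        ... | refl with distinct b e
        ... | refl rewrite dec-true (next (b , i) ≟ next (b , i)) refl = refl

    spoke : Fin v → Fin 3 × Bool → Fin v
    spoke u (k , false) = prev (flagAt u k)
    spoke u (k , true)  = next (flagAt u k)

    step : Bool → Fin 3 × Bool → Fin 3 × Bool
    step d (k , false) = k , true
    step d (k , true)  = succ3 d k , false

    step-transitive : ∀ d p q → ∃[ m ] iter (suc m) (step d) p ≡ q
    step-transitive d (k , s) (k′ , s′) with succ3-orbit d k k′
    step-transitive d (k , false) (_ , false) | inj₁ refl        = 5 , cong (_, false) (succ3-cube d k)
    step-transitive d (k , false) (_ , true)  | inj₁ refl        = 0 , refl
    step-transitive d (k , true)  (_ , false) | inj₁ refl        = 4 , cong (_, false) (succ3-cube d k)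
    step-transitive d (k , true)  (_ , true)  | inj₁ refl        = 5 , cong (_, true) (succ3-cube d k)
    step-transitive d (k , false) (_ , false) | inj₂ (inj₁ refl) = 1 , refl
    step-transitive d (k , false) (_ , true)  | inj₂ (inj₁ refl) = 2 , refl
    step-transitive d (k , true)  (_ , false) | inj₂ (inj₁ refl) = 0 , refl
    step-transitive d (k , true)  (_ , true)  | inj₂ (inj₁ refl) = 1 , refl
    step-transitive d (k , false) (_ , false) | inj₂ (inj₂ refl) = 3 , refl
    step-transitive d (k , false) (_ , true)  | inj₂ (inj₂ refl) = 4 , refl
    step-transitive d (k , true)  (_ , false) | inj₂ (inj₂ refl) = 2 , refl
    step-transitive d (k , true)  (_ , true)  | inj₂ (inj₂ refl) = 3 , refl

    rotation-spoke : ∀ c u p → rotation c u (spoke u p) ≡ spoke u (step (lookup c u) p)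
    rotation-spoke c u (k , false) = rotation-prev c (flagAt u k) (point-flagAt u k)
    rotation-spoke c u (k , true)  =
      trans (rotation-next c (flagAt u k) (point-flagAt u k)) (cong prev (σ-flagAt (lookup c u) u k))

    spoke-adjacent : ∀ u p → KAdj blk u (spoke u p)
    spoke-adjacent u (k , false) = adjacent-prev (flagAt u k) (point-flagAt u k)
    spoke-adjacent u (k , true)  = adjacent-next (flagAt u k) (point-flagAt u k)

    spoke-complete : ∀ {u w} → KAdj blk u w → ∃[ p ] w ≡ spoke u p
    spoke-complete u~w with neighbour u~w
    ... | f , refl , inj₁ w≡prev = (flagIndex f , false) , trans w≡prev (cong prev (sym (flagAt-flagIndex f)))
    ... | f , refl , inj₂ w≡next = (flagIndex f , true)  , trans w≡next (cong next (sym (flagAt-flagIndex f)))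

    rotation-isRotation : ∀ c → IsRotation X (rotation c)
    rotation-isRotation c = closed , transitive
      where
        closed : ∀ u w → KAdj blk u w → KAdj blk u (rotation c u w)
        closed u w u~w with spoke-complete u~w
        ... | p , refl = subst (KAdj blk u) (sym (rotation-spoke c u p)) (spoke-adjacent u (step (lookup c u) p))
        transitive : ∀ u w w′ → KAdj blk u w → KAdj blk u w′ → ∃[ k ] iter (suc k) (rotation c u) w ≡ w′
        transitive u w w′ u~w u~w′ with spoke-complete u~w | spoke-complete u~w′
        ... | p , refl | q , refl with step-transitive (lookup c u) p q
        ... | m , p↦q =
          m , trans (iter-commute {f = rotation c u} {F = step (lookup c u)} (spoke u) (rotation-spoke c u) (suc m) p)
                    (cong (spoke u) p↦q)

    rotation-blockFaces : ∀ c → BlockFacesOriented X o (rotation c)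
    rotation-blockFaces c b i =
      subst (λ j → rotation c (blk b (succ3 (o b) i)) (blk b j) ≡ blk b (succ3 (o b) (succ3 (o b) i)))
            (succ3-cube (o b) i) (rotation-prev c (b , succ3 (o b) i) refl)

    dart : Flag → Dart X
    dart f = next f , point f

    faceStep-dart : ∀ {A} c → (∀ x → x ∈ A) → ∀ f → faceStep X (rotation c) (dart f) ≡ dart (face A c f)
    faceStep-dart c full f = begin
      point f , rotation c (point f) (next f)    ≡⟨ cong (point f ,_) (rotation-next c f refl) ⟩
      point f , prev g                           ≡⟨ cong (_, prev g) (trans (sym (point-σ _ f)) (sym (next-ρ g))) ⟩
      dart (ρ g)                                 ≡⟨ cong dart (face-active c f (full (point f))) ⟨
      dart (face _ c f)                          ∎
      where
        open ≡-Reasoning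
        g : Flag
        g = σ (lookup c (point f)) f

    dart-outer : ∀ f → OuterDart X o (dart f)
    dart-outer (b , i) = (≢-sym (point≢next (b , i)) , b , (_ , refl) , (i , refl)) , not-block
      where
        not-block : ¬ BlockDart X o (dart (b , i))
        not-block (b′ , i′ , e₁ , e₂)
          with linear _ _ b′ b (≢-sym (point≢next (b , i))) (i′ , e₁) (_ , e₂) (_ , refl) (i , refl)
        ... | refl = succ3²-≢ (o b) i (trans (cong (succ3 (o b)) (sym (distinct b e₁))) (distinct b e₂))

    outer-dart : ∀ d → OuterDart X o d → ∃[ f ] d ≡ dart f
    outer-dart (u , w) (u~w , not-block) with neighbour u~w
    ... | (b , i) , refl , inj₁ w≡prev = ρ (b , i) , cong₂ _,_ (sym (next-ρ (b , i))) w≡prev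
    ... | (b , i) , refl , inj₂ w≡next = contradiction (b , i , refl , sym w≡next) not-block

    upper-embedding : ∀ {A} c {h} → (∀ x → x ∈ A) → Cycle (face A c) (λ _ → 1) h → UpperEmbeddableIn X o
    upper-embedding {A} c {h} full C =
      rotation c , rotation-isRotation c , rotation-blockFaces c , dart h , dart-outer h , reaches
      where
        reaches : ∀ d → OuterDart X o d → ∃[ k ] iter k (faceStep X (rotation c)) (dart h) ≡ d
        reaches d outer with outer-dart d outer
        ... | f , refl with cycle-reaches C (s≤s z≤n)
        ... | k , h↦f =
          k , trans (iter-commute {f = faceStep X (rotation c)} {F = face A c} dart (faceStep-dart c full) k h)
                    (cong dart h↦f)

    -- Deciding the remaining points

    record OneCycle : Set where
      constructor one-cycle
      field
        active : Subset v
        choice : Vec Bool v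
        start  : Flag
        orbit  : Cycle (face active choice) (λ _ → 1) start

    activate : (st : OneCycle) → ∀ {x} → x ∉ OneCycle.active st →
               Σ OneCycle (λ st′ → OneCycle.active st′ ≡ insert x (OneCycle.active st))
    activate (one-cycle A c h C) {x} x∉A
      with cycle-twist (cycle-rotate C (s≤s z≤n)) (λ _ → ≤-refl) (s≤s z≤n) (s≤s z≤n)
                       (flagAt-≢ x λ ()) (flagAt-≢ x λ ()) (flagAt-≢ x λ ())
                       (twist-at {c = c} x∉A true zero) (twist-at {c = c} x∉A false zero)
    ... | inj₁ C⁺ = one-cycle (insert x A) (c [ x ]≔ true) _ C⁺ , refl
    ... | inj₂ C⁻ = one-cycle (insert x A) (c [ x ]≔ false) _ C⁻ , refl

    activate-all : ∀ (xs : List (Fin v)) → OneCycle → Σ OneCycle (λ st → All (_∈ OneCycle.active st) xs)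
    activate-all []       st = st , []
    activate-all (x ∷ xs) st with activate-all xs st
    ... | st₁ , xs-active with x ∈? OneCycle.active st₁
    ... | yes x-active = st₁ , x-active ∷ xs-active
    ... | no  x-idle with activate st₁ x-idle
    ... | st₂ , refl = st₂ , x∈insert x _ ∷ All.map (⊆-insert x _) xs-active

    -- Merging the blocks along S

    module Merging (S : Subset v) (connected : InducedConnected blk S) (∣S∣-half : suc (2 * ∣ S ∣) ≡ v) where
      open Saturation S connected

      record BlockCluster : Set where
        constructor cluster
        field
          active   : Subset v
          blocks   : Subset v
          choice   : Vec Bool v
          start    : Flag
          orbit    : Cycle (face active choice) (onBlocks blocks) start
          active⊆S : active ⊆ S
          closed   : BlocksThrough active ⊆ blocks
          size     : ∣ blocks ∣ ≡ suc (2 * ∣ active ∣)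

      open BlockCluster

      initial : Fin v → BlockCluster
      initial b = cluster ∅ ⁅ b ⁆ (replicate v true) (b , zero)
        (block-cycle (replicate v true) (b , zero) (λ _ → ∉⊥)) ⊥⊆ (λ x∈∅ → contradiction x∈∅ ∉⊥)
        (trans (∣⁅x⁆∣≡1 b) (cong (λ n → suc (2 * n)) (sym (∣⊥∣≡0 v))))

      merge-at : (cl : BlockCluster) → ∀ {s} → s ∈ S → s ∉ active cl → ∀ k → blockAt s k ∈ blocks cl →
                 blockAt s (succ3 true k) ∉ blocks cl → blockAt s (succ3 true (succ3 true k)) ∉ blocks cl →
                 Σ BlockCluster (λ cl′ → ∣ active cl′ ∣ ≡ suc ∣ active cl ∣)
      merge-at (cluster U M c h cyc U⊆S closed size) {s} s∈S s∉U k a∈M B∉M C∉M =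
        cluster (insert s U) M′ (c [ s ]≔ true) (flagAt s k) merged (insert-⊆ s∈S U⊆S)
                (BlocksThrough-insert closed M⊆M′ (blockAt-all∈ k (M⊆M′ a∈M) B∈M′ C∈M′)) size′ ,
        ∣U′∣
        where
          open ≡-Reasoning
          k₁ k₂ : Fin 3
          k₁ = succ3 true k
          k₂ = succ3 true k₁
          B C : Fin v
          B = blockAt s k₁
          C = blockAt s k₂
          C∉insert : C ∉ insert B M
          C∉insert C∈ with ∈-insert⁻ M C∈
          ... | inj₁ C≡B = succ3-≢ true k₁ (blockAt-injective s C≡B)
          ... | inj₂ C∈M = C∉M C∈M
          M′ : Subset v
          M′ = insert C (insert B M)
          M⊆M′ : M ⊆ M′
          M⊆M′ = ⊆-insert C _ ∘ ⊆-insert B M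
          B∈M′ : B ∈ M′
          B∈M′ = ⊆-insert C _ (x∈insert B M)
          C∈M′ : C ∈ M′
          C∈M′ = x∈insert C (insert B M)
          joint : ∀ z → onBlocks M z + onBlocks ⁅ B ⁆ z + onBlocks ⁅ C ⁆ z ≡ onBlocks M′ z
          joint z = trans (cong (_+ onBlocks ⁅ C ⁆ z) (onBlocks-insert z B∉M)) (onBlocks-insert z C∉insert)
          inactive : ∀ {b} → b ∉ M → ∀ j → blk b j ∉ U
          inactive b∉M j y∈U = b∉M (closed y∈U (j , refl))
          merged : Cycle (face (insert s U) (c [ s ]≔ true)) (onBlocks M′) (flagAt s k)
          merged = cycle-cong (λ _ → refl) joint
            (cycle-merge₃ (cycle-rotate cyc (≤-reflexive (sym (onBlocks-∈ (flagAt s k) a∈M))))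
                          (block-cycle c (flagAt s k₁) (inactive B∉M))
                          (block-cycle c (flagAt s k₂) (inactive C∉M))
                          (λ z → subst (_≤ 1) (sym (joint z)) (onBlocks≤1 M′ z))
                          (twist-at {c = c} s∉U true k))
          ∣U′∣ : ∣ insert s U ∣ ≡ suc ∣ U ∣
          ∣U′∣ = ∣insert∣-∉ U s∉U
          size′ : ∣ M′ ∣ ≡ suc (2 * ∣ insert s U ∣)
          size′ = begin
            ∣ M′ ∣                    ≡⟨ ∣insert∣-∉ (insert B M) C∉insert ⟩
            suc ∣ insert B M ∣        ≡⟨ cong suc (∣insert∣-∉ M B∉M) ⟩
            suc (suc ∣ M ∣)           ≡⟨ cong (2 +_) size ⟩
            suc (2 + 2 * ∣ U ∣)       ≡⟨ cong suc (*-suc 2 ∣ U ∣) ⟨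
            suc (2 * suc ∣ U ∣)       ≡⟨ cong (λ n → suc (2 * n)) ∣U′∣ ⟨
            suc (2 * ∣ insert s U ∣)  ∎

      lone-out-impossible : (cl : BlockCluster) → ∀ {s} → s ∈ S → s ∉ active cl → ∀ k → blockAt s k ∉ blocks cl →
                            blockAt s (succ3 true k) ∈ blocks cl → blockAt s (succ3 true (succ3 true k)) ∈ blocks cl → ⊥
      lone-out-impossible (cluster U M c h cyc U⊆S closed size) {s} s∈S s∉U k A∉M b∈M c∈M =
        <-irrefl (sym dense) (2∣U∣<∣M∣ ∣S∣-half (insert-⊆ s∈S U⊆S)
          (BlocksThrough-insert closed (⊆-insert A M) (blockAt-all∈ k (x∈insert A M) (⊆-insert A M b∈M) (⊆-insert A M c∈M)))
          (x∈insert A M))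
        where
          open ≡-Reasoning
          A : Fin v
          A = blockAt s k
          dense : ∣ insert A M ∣ ≡ 2 * ∣ insert s U ∣
          dense = begin
            ∣ insert A M ∣           ≡⟨ ∣insert∣-∉ M A∉M ⟩
            suc ∣ M ∣                ≡⟨ cong suc size ⟩
            2 + 2 * ∣ U ∣            ≡⟨ *-suc 2 ∣ U ∣ ⟨
            2 * suc ∣ U ∣            ≡⟨ cong (2 *_) (∣insert∣-∉ U s∉U) ⟨
            2 * ∣ insert s U ∣       ∎

      grow : (cl : BlockCluster) → (∀ b → b ∈ blocks cl) ⊎ Σ BlockCluster (λ cl′ → ∣ active cl′ ∣ ≡ suc ∣ active cl ∣)
      grow cl with full-or-frontier (closed cl) (onBlocks-pos (start cl) (cycle-start (orbit cl)))
      ... | inj₁ full = inj₁ full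
      ... | inj₂ fr with odd-one-out (λ k → blockAt (Frontier.pivot fr) k ∈? blocks cl)
      ...   | all-in all∈   = let k , k↦outer = blockAt-complete pivot∈outer in
                              contradiction (subst (_∈ blocks cl) k↦outer (all∈ k)) outer∉M
        where open Frontier fr
      ...   | all-out all∉  = let k , k↦inner = blockAt-complete pivot∈inner in
                              contradiction (subst (_∈ blocks cl) (sym k↦inner) inner∈M) (all∉ k)
        where open Frontier fr
      ...   | lone-in k p₀ p₁ p₂  = inj₂ (merge-at cl (Frontier.pivot∈S fr) (Frontier.pivot∉U fr) k p₀ p₁ p₂)
      ...   | lone-out k p₀ p₁ p₂ = ⊥-elim (lone-out-impossible cl (Frontier.pivot∈S fr) (Frontier.pivot∉U fr) k p₀ p₁ p₂)

      saturate : ∀ n (cl : BlockCluster) → ∣ active cl ∣ + n ≡ ∣ S ∣ → Σ BlockCluster (λ cl → ∀ b → b ∈ blocks cl)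
      saturate n cl fuel with grow cl
      ... | inj₁ full = cl , full
      ... | inj₂ (cl′ , grew) with n
      ...   | zero  = ⊥-elim (1+n≰n (subst (_≤ ∣ S ∣) (trans grew (cong suc (trans (sym (+-identityʳ _)) fuel)))
                                                (p⊆q⇒∣p∣≤∣q∣ (active⊆S cl′))))
      ...   | suc n = saturate n cl′ (trans (cong (_+ n) grew) (trans (sym (+-suc _ n)) fuel))

      one-cycle-of : (cl : BlockCluster) → (∀ b → b ∈ blocks cl) → OneCycle
      one-cycle-of cl full =
        one-cycle (active cl) (choice cl) (start cl) (cycle-cong (λ _ → refl) (λ f → onBlocks-∈ f (full _)) (orbit cl))

half-of-odd : ∀ {v s} → v % 2 ≡ 1 → s ≡ (v ∸ 1) / 2 → suc (2 * s) ≡ v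
half-of-odd {v} {s} v-odd s≡ = begin
  suc (2 * s)       ≡⟨ cong suc (*-comm 2 s) ⟩
  suc (s * 2)       ≡⟨ cong (λ m → suc (m * 2)) s≡half ⟩
  suc (v / 2 * 2)   ≡⟨ v≡ ⟨
  v                 ∎
  where
    open ≡-Reasoning
    v≡ : v ≡ suc (v / 2 * 2)
    v≡ = trans (m≡m%n+[m/n]*n v 2) (cong (_+ v / 2 * 2) v-odd)
    s≡half : s ≡ v / 2
    s≡half = trans s≡ (trans (cong (λ m → (m ∸ 1) / 2) v≡) (m*n/n≡m (v / 2) 2))

theorem3p1 : ∀ (v : ℕ) (X : SymConfig v) → v % 2 ≡ 1 → 7 ≤ v
    → (S : Subset v) → ∣ S ∣ ≡ (v ∸ 1) / 2
    → (∀ b → ∃[ p ] (p ∈ S × _∈ᵇ_ (SymConfig.blk X) p b))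
    → InducedConnected (SymConfig.blk X) S
    → UpperEmbeddableInEveryOrientation X
-- 7 ≤ v only serves to exclude v = 0, and that S meets every block follows from the
-- connectivity of the induced subgraph.
theorem3p1 zero    _ _     ()  _ _     _ _         _
theorem3p1 (suc n) X v-odd _   S ∣S∣≡ _ connected o =
  upper-embedding (OneCycle.choice final) all-active (OneCycle.orbit final)
  where
    open Configuration X
    open Oriented o
    open Merging S connected (half-of-odd v-odd ∣S∣≡)
    saturated : Σ BlockCluster (λ cl → ∀ b → b ∈ BlockCluster.blocks cl)
    saturated = saturate ∣ S ∣ (initial zero) (cong (_+ ∣ S ∣) (∣⊥∣≡0 (suc n)))
    activated : Σ OneCycle (λ st → All (_∈ OneCycle.active st) (allFin (suc n)))
    activated = activate-all (allFin (suc n)) (one-cycle-of (proj₁ saturated) (proj₂ saturated))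
    final : OneCycle
    final = proj₁ activated
    all-active : ∀ x → x ∈ OneCycle.active final
    all-active x = All.lookup (proj₂ activated) (∈-allFin x)
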